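{- Let $n\ge 1$ and $\pi\in\mathcal D^1_{2n}(2413,3142)$ with last entry $2k-1$, decomposed into blocks $\pi=\cdots A_i B_i\cdots A_1 B_0\,(2k)\,A_0\,(2k-1)$ as described in the context. Then for every $i$, $\tau(A_i)$ and $c(\tau(B_i))$ are Dumont permutations of the first kind that avoid both $2413$ and $3142$.
   Context: A Dumont permutation of the first kind of length $2m$ is a permutation $\sigma$ of $\{1,\dots,2m\}$ such that every even entry is not last and is followed by a smaller entry, and every odd entry is either last or followed by a larger entry (the empty permutation counts, for $m=0$). $\mathcal D^1_{2n}(2413,3142)$ is the set of those of length $2n$ containing no subsequence order-isomorphic to $2413$ or $3142$. For a string $W$ of distinct integers, $\tau(W)$ is the permutation of $\{1,\dots,|W|\}$ order-isomorphic to $W$; for a permutation $a_1\cdots a_m$, its complement is $c(a_1\cdots a_m)=b_1\cdots b_m$ with $b_i=m+1-a_i$. Block decomposition: if the last entry is $2k-1$, let $A_0$ be the (possibly empty) string of entries strictly between $2k$ and the last entry. The prefix of $\pi$ preceding $2k$ consists of entries each either $<2k-1$ or $>2k$; split it into maximal runs of consecutive entries all $<2k-1$ or all $>2k$. If the run immediately preceding $2k$ consists of entries $>2k$ it is $B_0$, otherwise $B_0$ is empty; moving leftwards the remaining runs alternate and are named $A_1,B_1,A_2,B_2,\dots$, where the $A_i$ ($i\ge1$) consist of entries $<2k-1$ and the $B_i$ of entries $>2k$. -}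

module Defs where

open import Data.Nat using (ℕ; zero; suc; _+_; _*_; _∸_; _<_; _%_; _<ᵇ_)
open import Data.Nat.Properties using (_<?_)
open import Data.List using (List; []; _∷_; _++_; map; length; reverse; upTo; filter; takeWhileᵇ; dropWhileᵇ)
open import Data.List.Relation.Binary.Permutation.Propositional using (_↭_)
open import Data.List.Relation.Binary.Sublist.Propositional using (_⊆_)
open import Data.Product using (Σ; _×_)
open import Data.Bool using (Bool)
open import Data.Empty using (⊥)
open import Data.Unit using (⊤)
open import Relation.Binary.PropositionalEquality using (_≡_)
open import Relation.Nullary using (¬_)

IsPerm : List ℕ → Set
IsPerm σ = σ ↭ map suc (upTo (length σ))

DumontCond : List ℕ → Set
DumontCond [] = ⊤
DumontCond (x ∷ []) = x % 2 ≡ 0 → ⊥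
DumontCond (x ∷ y ∷ rest) =
  (x % 2 ≡ 0 → y < x) × (x % 2 ≡ 1 → x < y) × DumontCond (y ∷ rest)

IsDumont1 : List ℕ → Set
IsDumont1 σ = IsPerm σ × length σ % 2 ≡ 0 × DumontCond σ

τ : List ℕ → List ℕ
τ W = map (λ x → suc (length (filter (_<? x) W))) W

c : List ℕ → List ℕ
c σ = map (λ a → suc (length σ) ∸ a) σ

Contains : List ℕ → List ℕ → Set
Contains σ p = Σ (List ℕ) (λ s → (s ⊆ σ) × τ s ≡ p)

Avoids2413-3142 : List ℕ → Set
Avoids2413-3142 σ =
  ¬ Contains σ (2 ∷ 4 ∷ 1 ∷ 3 ∷ []) × ¬ Contains σ (3 ∷ 1 ∷ 4 ∷ 2 ∷ [])

InD1 : ℕ → List ℕ → Set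
InD1 n π = length π ≡ 2 * n × IsDumont1 π × Avoids2413-3142 π

-- Block decomposition. The prefix P preceding 2k is read right-to-left
-- (as reverse P) and cut into maximal runs of "high" entries (> 2k) and
-- "low" entries (< 2k−1).
high : ℕ → ℕ → Bool
high k x = 2 * k <ᵇ x

low : ℕ → ℕ → Bool
low k x = x <ᵇ 2 * k ∸ 1

-- restB k i L : what remains of the reversed prefix L after removing
-- B₀, A₁, B₁, …, Aᵢ (i.e. the string starting at Bᵢ, read right-to-left).
restB : ℕ → ℕ → List ℕ → List ℕ
restB k zero L = L
restB k (suc i) L = dropWhileᵇ (low k) (dropWhileᵇ (high k) (restB k i L))

-- Bᵢ (i ≥ 0), for the prefix P preceding 2k; empty if no such block exists.
blockB : ℕ → List ℕ → ℕ → List ℕ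
blockB k P i = reverse (takeWhileᵇ (high k) (restB k i (reverse P)))

-- Aᵢ: A₀ is the given string between 2k and the last entry; for i ≥ 1,
-- Aᵢ is the low run following (leftwards) Bᵢ₋₁; empty if none exists.
blockA : ℕ → List ℕ → List ℕ → ℕ → List ℕ
blockA k A₀ P zero = A₀
blockA k A₀ P (suc i) =
  reverse (takeWhileᵇ (low k) (dropWhileᵇ (high k) (restB k i (reverse P))))

-- Write K = 2k − 1 and M = 2k. Every entry of P is low (< K) or high (> M), and the blocks Aᵢ (i ≥ 1) and Bᵢ
-- are the maximal runs of lows and of highs in P. Avoiding 2413 (with M playing the 3) forces lows separated
-- by a high to increase from left to right, and avoiding 3142 (with K playing the 2) forces highs separated by
-- a low to decrease; the entries of A₀ are lows exceeding every low of P. Hence Aᵢ occupies the values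
-- c + 1, …, c + |Aᵢ|, where c is the number of lows to its left, and Bᵢ the values N − d − |Bᵢ| + 1, …, N − d,
-- where d is the number of highs to its left. Standardising Aᵢ is a shift of values, and standardising and
-- complementing Bᵢ a reflection; either preserves the Dumont condition once c, resp. d, is even. This holds
-- because in a Dumont permutation the least entry c + 1 of a nonempty Aᵢ must be odd (an even entry needs a
-- smaller successor) and the greatest entry N − d of a nonempty Bᵢ even; the block lengths are then even as
-- differences of such counts, and for A₀ one has |A₀| + c = K − 1. Avoidance passes to subsequences.

module Submission where

open import Defs
open import Data.Bool using (Bool; true; false; T)
open import Data.Empty using (⊥-elim)
open import Data.List
  using (List; []; _∷_; _++_; [_]; _∷ʳ_; map; length; filter; upTo; reverse; head; takeWhileᵇ; dropWhileᵇ)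
open import Data.List.Extrema.Nat using (min; max; argmin-sel; argmax-sel; min≤⊤; min≤xs; ⊥≤max; xs≤max)
open import Data.List.Membership.Propositional using (_∈_)
open import Data.List.Membership.Propositional.Properties
  using (∈-map⁻; ∈-map⁺; ∈-upTo⁻; ∈-++⁻; ∈-++⁺ˡ; ∈-++⁺ʳ; ∈-∃++)
open import Data.List.Properties
  using (filter-++; filter-none; filter-all; filter-accept; filter-reject; filter-notAll; length-++; length-map;
         length-reverse; length-upTo; map-∘; map-cong-local; map-++; map-applyUpTo; upTo-∷ʳ; ++-assoc;
         ++-identityʳ; reverse-++; reverse-involutive; reverse-injective; unfold-reverse; takeWhile++dropWhile)
open import Data.List.Relation.Binary.Permutation.Propositional
  using (_↭_; ↭-refl; ↭-sym; ↭-prep; ↭⇒↭ₛ; module PermutationReasoning)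
open import Data.List.Relation.Binary.Permutation.Propositional.Properties
  using (↭-length; filter-↭; ∷↭∷ʳ; map⁺; ∈-resp-↭; All-resp-↭; ↭-reverse)
import Data.List.Relation.Binary.Permutation.Setoid.Properties as Permutationₛ
open import Data.List.Relation.Binary.Sublist.Propositional using (_⊆_; ⊆-refl; ⊆-trans)
import Data.List.Relation.Binary.Sublist.Propositional as Sublist
open import Data.List.Relation.Binary.Sublist.Propositional.Properties
  using (length-mono-≤; filter⁺; ++⁺; ++⁺ˡ; ++⁺ʳ)
open import Data.List.Relation.Unary.All as All using (All; []; _∷_)
import Data.List.Relation.Unary.All.Properties as AllP
open import Data.List.Relation.Unary.AllPairs as AllPairs using (AllPairs; []; _∷_)
open import Data.List.Relation.Unary.Any as Any using (here; there)
open import Data.List.Relation.Unary.Linked using (Linked; []; [-]; _∷_)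
open import Data.List.Relation.Unary.Linked.Properties using (Linked⇒AllPairs)
open import Data.List.Relation.Unary.Unique.Propositional using (Unique)
import Data.List.Relation.Unary.Unique.Propositional.Properties as Unique
open import Data.Maybe.Relation.Unary.All as Maybe using (just; nothing)
open import Data.Nat using (ℕ; zero; suc; _+_; _*_; _∸_; _≤_; _<_; _%_; z≤n; s≤s; z<s; s<s; s<s⁻¹)
open import Data.Nat.Properties
open import Data.List.Sort ≤-decTotalOrder using (sort; sort-↭; sort-↗)
open import Data.Product using (∃; _×_; _,_; proj₁; proj₂)
open import Data.Sum using (_⊎_; inj₁; inj₂; [_,_]′; swap)
open import Data.Unit using (tt)
open import Function using (_∘_; id; case_of_)
open import Relation.Binary.Definitions using (tri<; tri≈; tri>)
open import Relation.Binary.PropositionalEquality hiding ([_])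
open import Relation.Nullary using (¬_; yes; no)
open import Relation.Nullary.Decidable using (T?)
open import Relation.Unary as U using (∁)

unique-↭ : ∀ {A B} → A ↭ B → Unique A → Unique B
unique-↭ A↭B = Permutationₛ.Unique-resp-↭ (setoid ℕ) (↭⇒↭ₛ A↭B)

unique-++⁻ʳ : ∀ (U : List ℕ) {L} → Unique (U ++ L) → Unique L
unique-++⁻ʳ [] u = u
unique-++⁻ʳ (_ ∷ U) (_ ∷ u) = unique-++⁻ʳ U u

unique-++⁻ˡ : ∀ (U : List ℕ) {L} → Unique (U ++ L) → Unique U
unique-++⁻ˡ [] _ = []
unique-++⁻ˡ (_ ∷ U) (x∉ ∷ u) = AllP.++⁻ˡ U x∉ ∷ unique-++⁻ˡ U u

unique-++-disjoint : ∀ (U : List ℕ) {L a b} → Unique (U ++ L) → a ∈ U → b ∈ L → a ≢ b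
unique-++-disjoint (_ ∷ U) (x∉ ∷ _) (here refl) b∈ = All.lookup (AllP.++⁻ʳ U x∉) b∈
unique-++-disjoint (_ ∷ U) (_ ∷ u) (there a∈) b∈ = unique-++-disjoint U u a∈ b∈

∈⇒≢[] : ∀ {x} {L : List ℕ} → x ∈ L → L ≢ []
∈⇒≢[] (here _) ()
∈⇒≢[] (there _) ()

≡[]⊎≢[] : ∀ (L : List ℕ) → L ≡ [] ⊎ L ≢ []
≡[]⊎≢[] [] = inj₁ refl
≡[]⊎≢[] (_ ∷ _) = inj₂ λ ()

All-reverse : ∀ {Q : ℕ → Set} {L} → All Q L → All Q (reverse L)
All-reverse {L = L} = All-resp-↭ (↭-sym (↭-reverse L))

head-++ : ∀ {Q : ℕ → Set} {A} B → All Q A → A ≢ [] → Maybe.All Q (head (A ++ B))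
head-++ B [] A≢[] = ⊥-elim (A≢[] refl)
head-++ B (q ∷ _) _ = just q

head-resolve : ∀ {Q R S : ℕ → Set} {L} → All (λ z → Q z ⊎ R z) L → Maybe.All S (head L) →
               (∀ {z} → S z → ¬ R z) → Maybe.All Q (head L)
head-resolve [] _ _ = nothing
head-resolve (inj₁ q ∷ _) _ _ = just q
head-resolve (inj₂ r ∷ _) (just s) S⇒¬R = ⊥-elim (S⇒¬R s r)

head-dropWhileᵇ : ∀ (p : ℕ → Bool) L → Maybe.All (λ z → ¬ T (p z)) (head (dropWhileᵇ p L))
head-dropWhileᵇ p [] = nothing
head-dropWhileᵇ p (x ∷ L) with p x in eq
... | true = head-dropWhileᵇ p L
... | false = just (subst T eq)

takeWhileᵇ-≡[] : ∀ (p : ℕ → Bool) L → Maybe.All (T ∘ p) (head L) → takeWhileᵇ p L ≡ [] → L ≡ []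
takeWhileᵇ-≡[] p [] _ _ = refl
takeWhileᵇ-≡[] p (x ∷ L) (just px) tw≡[] with p x
... | true = case tw≡[] of λ ()
... | false = ⊥-elim px

⊆-map⁻ : ∀ (f : ℕ → ℕ) X {t} → t ⊆ map f X → ∃ λ t′ → t′ ⊆ X × t ≡ map f t′
⊆-map⁻ f [] Sublist.[] = [] , Sublist.[] , refl
⊆-map⁻ f (x ∷ X) (_ Sublist.∷ʳ t⊆) with ⊆-map⁻ f X t⊆
... | t′ , t′⊆X , refl = t′ , x Sublist.∷ʳ t′⊆X , refl
⊆-map⁻ f (x ∷ X) (refl Sublist.∷ t⊆) with ⊆-map⁻ f X t⊆
... | t′ , t′⊆X , refl = x ∷ t′ , refl Sublist.∷ t′⊆X , refl

-- Counting the entries below and above a value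

count : ∀ {p} {P : ℕ → Set p} → U.Decidable P → List ℕ → ℕ
count P? L = length (filter P? L)

below above : ℕ → List ℕ → ℕ
below x = count (_<? x)
above x = count (x <?_)

module _ {p} {P : ℕ → Set p} (P? : U.Decidable P) where

  count-++ : ∀ A B → count P? (A ++ B) ≡ count P? A + count P? B
  count-++ A B = trans (cong length (filter-++ P? A B)) (length-++ (filter P? A))

  count-↭ : ∀ {A B} → A ↭ B → count P? A ≡ count P? B
  count-↭ A↭B = ↭-length (filter-↭ P? A↭B)

  count-none : ∀ {L} → All (∁ P) L → count P? L ≡ 0
  count-none h = cong length (filter-none P? h)

  count-all : ∀ {L} → All P L → count P? L ≡ length L
  count-all h = cong length (filter-all P? h)

  count-accept : ∀ {z} L → P z → count P? (z ∷ L) ≡ suc (count P? L)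
  count-accept L Pz = cong length (filter-accept P? Pz)

  count-reject : ∀ {z} L → ¬ P z → count P? (z ∷ L) ≡ count P? L
  count-reject L ¬Pz = cong length (filter-reject P? ¬Pz)

count-cong : ∀ {p q} {P : ℕ → Set p} {Q : ℕ → Set q} (P? : U.Decidable P) (Q? : U.Decidable Q) {L} →
             All (λ z → (P z → Q z) × (Q z → P z)) L → count P? L ≡ count Q? L
count-cong P? Q? [] = refl
count-cong P? Q? {z ∷ L} ((P⇒Q , Q⇒P) ∷ h) with P? z | Q? z
... | yes _  | yes _  = cong suc (count-cong P? Q? h)
... | yes Pz | no ¬Qz = ⊥-elim (¬Qz (P⇒Q Pz))
... | no ¬Pz | yes Qz = ⊥-elim (¬Pz (Q⇒P Qz))
... | no _   | no _   = count-cong P? Q? h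

below+above-∉ : ∀ {x} L → ¬ x ∈ L → below x L + above x L ≡ length L
below+above-∉ [] _ = refl
below+above-∉ {x} (z ∷ L) x∉ with <-cmp z x
... | tri< z<x _ x≮z = begin
  below x (z ∷ L) + above x (z ∷ L)
    ≡⟨ cong₂ _+_ (count-accept (_<? x) L z<x) (count-reject (x <?_) L x≮z) ⟩
  suc (below x L + above x L)
    ≡⟨ cong suc (below+above-∉ L (x∉ ∘ there)) ⟩
  suc (length L)                     ∎
  where open ≡-Reasoning
... | tri≈ _ refl _ = ⊥-elim (x∉ (here refl))
... | tri> z≮x _ x<z = begin
  below x (z ∷ L) + above x (z ∷ L)
    ≡⟨ cong₂ _+_ (count-reject (_<? x) L z≮x) (count-accept (x <?_) L x<z) ⟩
  below x L + suc (above x L)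
    ≡⟨ +-suc (below x L) (above x L) ⟩
  suc (below x L + above x L)
    ≡⟨ cong suc (below+above-∉ L (x∉ ∘ there)) ⟩
  suc (length L)                     ∎
  where open ≡-Reasoning

below+above : ∀ {x} L → Unique L → x ∈ L → suc (below x L + above x L) ≡ length L
below+above {x} (x ∷ L) (x∉L ∷ _) (here refl) = begin
  suc (below x (x ∷ L) + above x (x ∷ L))
    ≡⟨ cong suc (cong₂ _+_ (count-reject (_<? x) L (<-irrefl refl)) (count-reject (x <?_) L (<-irrefl refl))) ⟩
  suc (below x L + above x L)
    ≡⟨ cong suc (below+above-∉ L (λ x∈L → All.lookup x∉L x∈L refl)) ⟩
  suc (length L)                           ∎
  where open ≡-Reasoning
below+above {x} (z ∷ L) (z∉L ∷ u) (there x∈L) with <-cmp z x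
... | tri< z<x _ x≮z = begin
  suc (below x (z ∷ L) + above x (z ∷ L))
    ≡⟨ cong suc (cong₂ _+_ (count-accept (_<? x) L z<x) (count-reject (x <?_) L x≮z)) ⟩
  suc (suc (below x L + above x L))
    ≡⟨ cong suc (below+above L u x∈L) ⟩
  suc (length L)                           ∎
  where open ≡-Reasoning
... | tri≈ _ z≡x _ = ⊥-elim (All.lookup z∉L x∈L z≡x)
... | tri> z≮x _ x<z = begin
  suc (below x (z ∷ L) + above x (z ∷ L))
    ≡⟨ cong suc (cong₂ _+_ (count-reject (_<? x) L z≮x) (count-accept (x <?_) L x<z)) ⟩
  suc (below x L + suc (above x L))
    ≡⟨ cong suc (+-suc (below x L) (above x L)) ⟩
  suc (suc (below x L + above x L))
    ≡⟨ cong suc (below+above L u x∈L) ⟩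
  suc (length L)                           ∎
  where open ≡-Reasoning

below-mono : ∀ {x y} L → x ≤ y → below x L ≤ below y L
below-mono {x} {y} L x≤y =
  length-mono-≤ (filter⁺ (_<? x) (_<? y) (λ { refl z<x → <-≤-trans z<x x≤y }) (⊆-refl {x = L}))

below-mono-< : ∀ {x y} L → x ∈ L → x < y → below x L < below y L
below-mono-< {x} {y} (x ∷ L) (here refl) x<y = begin-strict
  below x (x ∷ L)  ≡⟨ count-reject (_<? x) L (<-irrefl refl) ⟩
  below x L        ≤⟨ below-mono L (<⇒≤ x<y) ⟩
  below y L        <⟨ n<1+n (below y L) ⟩
  suc (below y L)  ≡⟨ count-accept (_<? y) L x<y ⟨
  below y (x ∷ L)  ∎
  where open ≤-Reasoning
below-mono-< {x} {y} (z ∷ L) (there x∈L) x<y with z <? x | z <? y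
... | yes z<x | yes z<y = begin-strict
  below x (z ∷ L)  ≡⟨ count-accept (_<? x) L z<x ⟩
  suc (below x L)  <⟨ s<s (below-mono-< L x∈L x<y) ⟩
  suc (below y L)  ≡⟨ count-accept (_<? y) L z<y ⟨
  below y (z ∷ L)  ∎
  where open ≤-Reasoning
... | yes z<x | no z≮y = ⊥-elim (z≮y (<-trans z<x x<y))
... | no z≮x  | yes z<y = begin-strict
  below x (z ∷ L)  ≡⟨ count-reject (_<? x) L z≮x ⟩
  below x L        <⟨ m<n⇒m<1+n (below-mono-< L x∈L x<y) ⟩
  suc (below y L)  ≡⟨ count-accept (_<? y) L z<y ⟨
  below y (z ∷ L)  ∎
  where open ≤-Reasoning
... | no z≮x  | no z≮y = begin-strict
  below x (z ∷ L)  ≡⟨ count-reject (_<? x) L z≮x ⟩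
  below x L        <⟨ below-mono-< L x∈L x<y ⟩
  below y L        ≡⟨ count-reject (_<? y) L z≮y ⟨
  below y (z ∷ L)  ∎
  where open ≤-Reasoning

range : ℕ → List ℕ
range N = map suc (upTo N)

range-suc : ∀ N → range (suc N) ≡ 1 ∷ map suc (range N)
range-suc N = cong (λ L → 1 ∷ map suc L) (sym (map-applyUpTo id suc N))

range-∷ʳ : ∀ N → range N ∷ʳ suc N ≡ range (suc N)
range-∷ʳ N = trans (sym (map-++ suc (upTo N) [ N ])) (cong (map suc) (upTo-∷ʳ N))

length-range : ∀ N → length (range N) ≡ N
length-range N = trans (length-map suc (upTo N)) (length-upTo N)

∈-range⁻ : ∀ {N x} → x ∈ range N → 1 ≤ x × x ≤ N
∈-range⁻ x∈ with ∈-map⁻ suc x∈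
... | _ , i∈ , refl = s≤s z≤n , ∈-upTo⁻ i∈

unique-range : ∀ N → Unique (range N)
unique-range N = Unique.map⁺ suc-injective (Unique.upTo⁺ N)

below-map-suc : ∀ x L → below (suc x) (map suc L) ≡ below x L
below-map-suc x [] = refl
below-map-suc x (z ∷ L) with z <? x
... | yes z<x = trans (count-accept (_<? suc x) (map suc L) (s<s z<x))
                     (trans (cong suc (below-map-suc x L)) (sym (count-accept (_<? x) L z<x)))
... | no z≮x  = trans (count-reject (_<? suc x) (map suc L) (z≮x ∘ s<s⁻¹))
                     (trans (below-map-suc x L) (sym (count-reject (_<? x) L z≮x)))

above-map-suc : ∀ x L → above (suc x) (map suc L) ≡ above x L
above-map-suc x [] = refl
above-map-suc x (z ∷ L) with x <? z
... | yes x<z = trans (count-accept (suc x <?_) (map suc L) (s<s x<z))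
                     (trans (cong suc (above-map-suc x L)) (sym (count-accept (x <?_) L x<z)))
... | no x≮z  = trans (count-reject (suc x <?_) (map suc L) (x≮z ∘ s<s⁻¹))
                     (trans (above-map-suc x L) (sym (count-reject (x <?_) L x≮z)))

below-range : ∀ N {x} → x ≤ suc N → below x (range N) ≡ x ∸ 1
below-range N {zero} _ = count-none (_<? 0) {range N} (All.tabulate λ _ ())
below-range zero {suc zero} _ = refl
below-range zero {suc (suc _)} (s≤s ())
below-range (suc N) {suc zero} _ = begin
  below 1 (range (suc N))           ≡⟨ cong (below 1) (range-suc N) ⟩
  below 1 (1 ∷ map suc (range N))   ≡⟨ count-reject (_<? 1) (map suc (range N)) (<-irrefl refl) ⟩
  below 1 (map suc (range N))       ≡⟨ below-map-suc 0 (range N) ⟩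
  below 0 (range N)                 ≡⟨ below-range N z≤n ⟩
  0                                 ∎
  where open ≡-Reasoning
below-range (suc N) {suc (suc x)} (s≤s x<1+N) = begin
  below (2 + x) (range (suc N))          ≡⟨ cong (below (2 + x)) (range-suc N) ⟩
  below (2 + x) (1 ∷ map suc (range N))  ≡⟨ count-accept (_<? 2 + x) (map suc (range N)) (s<s z<s) ⟩
  suc (below (2 + x) (map suc (range N))) ≡⟨ cong suc (below-map-suc (suc x) (range N)) ⟩
  suc (below (suc x) (range N))          ≡⟨ cong suc (below-range N x<1+N) ⟩
  suc x                                  ∎
  where open ≡-Reasoning

above-range : ∀ N x → above x (range N) ≡ N ∸ x
above-range zero zero = refl
above-range zero (suc x) = refl
above-range (suc N) zero =
  trans (count-all (0 <?_) {range (suc N)} (All.tabulate (proj₁ ∘ ∈-range⁻))) (length-range (suc N))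
above-range (suc N) (suc x) = begin
  above (suc x) (range (suc N))          ≡⟨ cong (above (suc x)) (range-suc N) ⟩
  above (suc x) (1 ∷ map suc (range N))
    ≡⟨ count-reject (suc x <?_) {1} (map suc (range N)) (λ { (s≤s ()) }) ⟩
  above (suc x) (map suc (range N))      ≡⟨ above-map-suc x (range N) ⟩
  above x (range N)                      ≡⟨ above-range N x ⟩
  N ∸ x                                  ∎
  where open ≡-Reasoning

-- Standardisation and complement

rank : List ℕ → ℕ → ℕ
rank w x = suc (below x w)

rank≤length : ∀ {x} w → x ∈ w → rank w x ≤ length w
rank≤length {x} w x∈w = filter-notAll (_<? x) w (Any.map (λ { refl → <-irrefl refl }) x∈w)

OrderPreservingOn OrderReversingOn : (ℕ → ℕ) → List ℕ → Set
OrderPreservingOn f w = ∀ {x y} → x ∈ w → y ∈ w → x < y → f x < f y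
OrderReversingOn f w = ∀ {x y} → x ∈ w → y ∈ w → x < y → f y < f x

preserving-⊆ : ∀ {f t w} → t ⊆ w → OrderPreservingOn f w → OrderPreservingOn f t
preserving-⊆ t⊆w mono x∈ y∈ = mono (Sublist.lookup t⊆w x∈) (Sublist.lookup t⊆w y∈)

reversing-⊆ : ∀ {f t w} → t ⊆ w → OrderReversingOn f w → OrderReversingOn f t
reversing-⊆ t⊆w anti x∈ y∈ = anti (Sublist.lookup t⊆w x∈) (Sublist.lookup t⊆w y∈)

reversing-∘ : ∀ {g h w} → OrderReversingOn g w → OrderReversingOn h (map g w) → OrderPreservingOn (h ∘ g) w
reversing-∘ {g} g-anti h-anti x∈ y∈ x<y = h-anti (∈-map⁺ g y∈) (∈-map⁺ g x∈) (g-anti x∈ y∈ x<y)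

preserving⇒reflecting : ∀ {f w x y} → OrderPreservingOn f w → x ∈ w → y ∈ w → f x < f y → x < y
preserving⇒reflecting {x = x} {y} mono x∈ y∈ fx<fy with <-cmp x y
... | tri< x<y _ _ = x<y
... | tri≈ _ refl _ = ⊥-elim (<-irrefl refl fx<fy)
... | tri> _ _ y<x = ⊥-elim (<-asym fx<fy (mono y∈ x∈ y<x))

rank-preserving : ∀ w → OrderPreservingOn (rank w) w
rank-preserving w x∈ _ x<y = s<s (below-mono-< w x∈ x<y)

below-map : ∀ {f x} L → All (λ y → (y < x → f y < f x) × (f y < f x → y < x)) L →
            below (f x) (map f L) ≡ below x L
below-map [] [] = refl
below-map {f} {x} (y ∷ L) ((⇒ , ⇐) ∷ h) with y <? x
... | yes y<x = trans (count-accept (_<? f x) (map f L) (⇒ y<x))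
                      (trans (cong suc (below-map L h)) (sym (count-accept (_<? x) L y<x)))
... | no y≮x  = trans (count-reject (_<? f x) (map f L) (y≮x ∘ ⇐))
                      (trans (below-map L h) (sym (count-reject (_<? x) L y≮x)))

τ-map : ∀ {f} w → OrderPreservingOn f w → τ (map f w) ≡ τ w
τ-map {f} w mono = begin
  τ (map f w)                 ≡⟨ map-∘ w ⟨
  map (rank (map f w) ∘ f) w
    ≡⟨ map-cong-local (All.tabulate λ x∈ → cong suc (below-map w (All.tabulate λ y∈ →
         mono y∈ x∈ , preserving⇒reflecting mono y∈ x∈))) ⟩
  τ w                         ∎
  where open ≡-Reasoning

rank-sorted : ∀ S → AllPairs _<_ S → map (rank S) S ≡ range (length S)
rank-sorted [] [] = refl
rank-sorted (a ∷ S) (a<S ∷ sorted) = begin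
  rank (a ∷ S) a ∷ map (rank (a ∷ S)) S  ≡⟨ cong₂ _∷_ rank-head rank-tail ⟩
  1 ∷ map suc (range (length S))         ≡⟨ range-suc (length S) ⟨
  range (suc (length S))                 ∎
  where
  open ≡-Reasoning
  rank-head : rank (a ∷ S) a ≡ 1
  rank-head = cong suc (trans (count-reject (_<? a) S (<-irrefl refl))
                              (count-none (_<? a) (All.map (λ a<z z<a → <-asym a<z z<a) a<S)))
  rank-tail : map (rank (a ∷ S)) S ≡ map suc (range (length S))
  rank-tail = begin
    map (rank (a ∷ S)) S
      ≡⟨ map-cong-local (All.map (λ {z} a<z → cong suc (count-accept (_<? z) S a<z)) a<S) ⟩
    map (suc ∘ rank S) S   ≡⟨ map-∘ S ⟩
    map suc (map (rank S) S) ≡⟨ cong (map suc) (rank-sorted S sorted) ⟩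
    map suc (range (length S)) ∎

τ-isPerm : ∀ w → Unique w → IsPerm (τ w)
τ-isPerm w u = begin
  τ w                           ↭⟨ map⁺ (rank w) (↭-sym (sort-↭ w)) ⟩
  map (rank w) (sort w)
    ≡⟨ map-cong-local (All.tabulate λ _ → cong suc (count-↭ (_<? _) (↭-sym (sort-↭ w)))) ⟩
  map (rank (sort w)) (sort w)  ≡⟨ rank-sorted (sort w) sorted ⟩
  range (length (sort w))       ≡⟨ cong range (trans (↭-length (sort-↭ w)) (sym (length-map (rank w) w))) ⟩
  range (length (τ w))          ∎
  where
  open PermutationReasoning
  sorted : AllPairs _<_ (sort w)
  sorted = AllPairs.zipWith (λ (p , q) → ≤∧≢⇒< p q)
             (Linked⇒AllPairs ≤-trans (sort-↗ w) , unique-↭ (↭-sym (sort-↭ w)) u)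

complement-range : ∀ m → map (suc m ∸_) (range m) ↭ range m
complement-range zero = ↭-refl
complement-range (suc m) = begin
  map (suc (suc m) ∸_) (range (suc m))                ≡⟨ cong (map (suc (suc m) ∸_)) (range-suc m) ⟩
  suc m ∷ map (suc (suc m) ∸_) (map suc (range m))    ≡⟨ cong (suc m ∷_) (map-∘ (range m)) ⟨
  suc m ∷ map (suc m ∸_) (range m)                    ↭⟨ ↭-prep (suc m) (complement-range m) ⟩
  suc m ∷ range m                                     ↭⟨ ∷↭∷ʳ (suc m) (range m) ⟩
  range m ∷ʳ suc m                                    ≡⟨ range-∷ʳ m ⟩
  range (suc m)                                       ∎
  where open PermutationReasoning

c-isPerm : ∀ σ → IsPerm σ → IsPerm (c σ)
c-isPerm σ σ↭ = begin
  c σ                                        ↭⟨ map⁺ (suc (length σ) ∸_) σ↭ ⟩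
  map (suc (length σ) ∸_) (range (length σ)) ↭⟨ complement-range (length σ) ⟩
  range (length σ)                           ≡⟨ cong range (length-map (suc (length σ) ∸_) σ) ⟨
  range (length (c σ))                       ∎
  where open PermutationReasoning

corank : List ℕ → ℕ → ℕ
corank w x = suc (length w) ∸ rank w x

c∘τ : ∀ w → c (τ w) ≡ map (corank w) w
c∘τ w = trans (cong (λ m → map (suc m ∸_) (τ w)) (length-map (rank w) w)) (sym (map-∘ w))

corank-reversing : ∀ w → OrderReversingOn (corank w) w
corank-reversing w x∈ y∈ x<y =
  ∸-monoʳ-< (rank-preserving w x∈ y∈ x<y) (m≤n⇒m≤1+n (rank≤length w y∈))

rank-shift : ∀ {N} U X Y {c} → U ++ X ++ Y ↭ range N → (∀ {x} → x ∈ X → below x U ≡ c) →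
             (∀ {x z} → x ∈ X → z ∈ Y → x < z) → ∀ {x} → x ∈ X → rank X x + c ≡ x
rank-shift {N} U X Y {c} π↭ below-U <Y {x} x∈ = begin
  suc (below x X + c)                        ≡⟨ cong suc (+-comm (below x X) c) ⟩
  suc (c + below x X)
    ≡⟨ cong₂ (λ a b → suc (a + b)) (below-U x∈) (+-identityʳ (below x X)) ⟨
  suc (below x U + (below x X + 0))          ≡⟨ cong (λ b → suc (below x U + (below x X + b))) below-Y ⟨
  suc (below x U + (below x X + below x Y))  ≡⟨ cong (λ b → suc (below x U + b)) (count-++ (_<? x) X Y) ⟨
  suc (below x U + below x (X ++ Y))         ≡⟨ cong suc (count-++ (_<? x) U (X ++ Y)) ⟨
  suc (below x (U ++ X ++ Y))                ≡⟨ cong suc (count-↭ (_<? x) π↭) ⟩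
  suc (below x (range N))                    ≡⟨ cong suc (below-range N (m≤n⇒m≤1+n (proj₂ bounds))) ⟩
  suc (x ∸ 1)                                ≡⟨ m+[n∸m]≡n (proj₁ bounds) ⟩
  x                                          ∎
  where
  open ≡-Reasoning
  bounds : 1 ≤ x × x ≤ N
  bounds = ∈-range⁻ (∈-resp-↭ π↭ (∈-++⁺ʳ U (∈-++⁺ˡ x∈)))
  below-Y : below x Y ≡ 0
  below-Y = count-none (_<? x) (All.tabulate λ z∈ z<x → <-asym z<x (<Y x∈ z∈))

above-shift : ∀ {N} U X Y {d} → U ++ X ++ Y ↭ range N → (∀ {x} → x ∈ X → above x U ≡ d) →
              (∀ {x z} → x ∈ X → z ∈ Y → z < x) → ∀ {x} → x ∈ X → d + above x X + x ≡ N
above-shift {N} U X Y {d} π↭ above-U Y< {x} x∈ = begin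
  d + above x X + x
    ≡⟨ cong₂ (λ a b → a + b + x) (above-U x∈) (+-identityʳ (above x X)) ⟨
  above x U + (above x X + 0) + x            ≡⟨ cong (λ b → above x U + (above x X + b) + x) above-Y ⟨
  above x U + (above x X + above x Y) + x    ≡⟨ cong (λ b → above x U + b + x) (count-++ (x <?_) X Y) ⟨
  above x U + above x (X ++ Y) + x           ≡⟨ cong (_+ x) (count-++ (x <?_) U (X ++ Y)) ⟨
  above x (U ++ X ++ Y) + x                  ≡⟨ cong (_+ x) (count-↭ (x <?_) π↭) ⟩
  above x (range N) + x                      ≡⟨ cong (_+ x) (above-range N x) ⟩
  N ∸ x + x
    ≡⟨ m∸n+n≡m (proj₂ (∈-range⁻ (∈-resp-↭ π↭ (∈-++⁺ʳ U (∈-++⁺ˡ x∈))))) ⟩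
  N                                          ∎
  where
  open ≡-Reasoning
  above-Y : above x Y ≡ 0
  above-Y = count-none (x <?_) (All.tabulate λ z∈ x<z → <-asym x<z (Y< x∈ z∈))

-- Pattern containment

contains-τ : ∀ {π X p} → X ⊆ π → Contains (τ X) p → Contains π p
contains-τ {X = X} X⊆π (t , t⊆ , τt≡p) with ⊆-map⁻ (rank X) X t⊆
... | t′ , t′⊆X , refl =
  t′ , ⊆-trans t′⊆X X⊆π , trans (sym (τ-map t′ (preserving-⊆ t′⊆X (rank-preserving X)))) τt≡p

contains-c∘τ : ∀ {π X p} → X ⊆ π → Contains (c (τ X)) p → Contains π (τ (c p))
contains-c∘τ {X = X} X⊆π (t , t⊆ , refl) with ⊆-map⁻ (corank X) X (subst (_ ⊆_) (c∘τ X) t⊆)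
... | t′ , t′⊆X , refl = t′ , ⊆-trans t′⊆X X⊆π , (begin
  τ t′
    ≡⟨ τ-map t′ (reversing-∘ (reversing-⊆ t′⊆X (corank-reversing X)) (corank-reversing q)) ⟨
  τ (map (corank q ∘ corank X) t′)        ≡⟨ cong τ (map-∘ t′) ⟩
  τ (map (corank q) q)                    ≡⟨ cong τ (c∘τ q) ⟨
  τ (c (τ q))                             ∎)
  where
  open ≡-Reasoning
  q : List ℕ
  q = map (corank X) t′

avoids-τ : ∀ {π X} → X ⊆ π → Avoids2413-3142 π → Avoids2413-3142 (τ X)
avoids-τ X⊆π (no2413 , no3142) = no2413 ∘ contains-τ X⊆π , no3142 ∘ contains-τ X⊆π

avoids-c∘τ : ∀ {π X} → X ⊆ π → Avoids2413-3142 π → Avoids2413-3142 (c (τ X))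
avoids-c∘τ X⊆π (no2413 , no3142) = no3142 ∘ contains-c∘τ X⊆π , no2413 ∘ contains-c∘τ X⊆π

τ-2413 : ∀ {a b c d} → c < a → a < d → d < b → τ (a ∷ b ∷ c ∷ d ∷ []) ≡ 2 ∷ 4 ∷ 1 ∷ 3 ∷ []
τ-2413 {a} {b} {c} {d} c<a a<d d<b =
  cong₂ _∷_ (cong suc below-a) (cong₂ _∷_ (cong suc below-b)
    (cong₂ _∷_ (cong suc below-c) (cong₂ _∷_ (cong suc below-d) refl)))
  where
  c<d : c < d
  c<d = <-trans c<a a<d
  a<b : a < b
  a<b = <-trans a<d d<b
  c<b : c < b
  c<b = <-trans c<d d<b
  below-a : below a (a ∷ b ∷ c ∷ d ∷ []) ≡ 1
  below-a = trans (count-reject (_<? a) _ (<-irrefl refl)) (trans (count-reject (_<? a) _ (<-asym a<b))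
            (trans (count-accept (_<? a) _ c<a) (cong suc (count-reject (_<? a) [] (<-asym a<d)))))
  below-b : below b (a ∷ b ∷ c ∷ d ∷ []) ≡ 3
  below-b = trans (count-accept (_<? b) _ a<b) (cong suc (trans (count-reject (_<? b) _ (<-irrefl refl))
            (trans (count-accept (_<? b) _ c<b) (cong suc (count-accept (_<? b) [] d<b)))))
  below-c : below c (a ∷ b ∷ c ∷ d ∷ []) ≡ 0
  below-c = count-none (_<? c) ((<-asym c<a) ∷ (<-asym c<b) ∷ (<-irrefl refl) ∷ (<-asym c<d) ∷ [])
  below-d : below d (a ∷ b ∷ c ∷ d ∷ []) ≡ 2
  below-d = trans (count-accept (_<? d) _ a<d) (cong suc (trans (count-reject (_<? d) _ (<-asym d<b))
            (trans (count-accept (_<? d) _ c<d) (cong suc (count-reject (_<? d) [] (<-irrefl refl))))))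

τ-3142 : ∀ {a b c d} → b < d → d < a → a < c → τ (a ∷ b ∷ c ∷ d ∷ []) ≡ 3 ∷ 1 ∷ 4 ∷ 2 ∷ []
τ-3142 {a} {b} {c} {d} b<d d<a a<c =
  cong₂ _∷_ (cong suc below-a) (cong₂ _∷_ (cong suc below-b)
    (cong₂ _∷_ (cong suc below-c) (cong₂ _∷_ (cong suc below-d) refl)))
  where
  b<a : b < a
  b<a = <-trans b<d d<a
  d<c : d < c
  d<c = <-trans d<a a<c
  b<c : b < c
  b<c = <-trans b<a a<c
  below-a : below a (a ∷ b ∷ c ∷ d ∷ []) ≡ 2
  below-a = trans (count-reject (_<? a) _ (<-irrefl refl)) (trans (count-accept (_<? a) _ b<a)
            (cong suc (trans (count-reject (_<? a) _ (<-asym a<c)) (count-accept (_<? a) [] d<a))))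
  below-b : below b (a ∷ b ∷ c ∷ d ∷ []) ≡ 0
  below-b = count-none (_<? b) ((<-asym b<a) ∷ (<-irrefl refl) ∷ (<-asym b<c) ∷ (<-asym b<d) ∷ [])
  below-c : below c (a ∷ b ∷ c ∷ d ∷ []) ≡ 3
  below-c = trans (count-accept (_<? c) _ a<c) (cong suc (trans (count-accept (_<? c) _ b<c)
            (cong suc (trans (count-reject (_<? c) _ (<-irrefl refl)) (count-accept (_<? c) [] d<c)))))
  below-d : below d (a ∷ b ∷ c ∷ d ∷ []) ≡ 1
  below-d = trans (count-reject (_<? d) _ (<-asym d<a)) (trans (count-accept (_<? d) _ b<d)
            (cong suc (trans (count-reject (_<? d) _ (<-asym d<c)) (count-reject (_<? d) [] (<-irrefl refl)))))

module _ (S₁ S₂ S₃ S₄ : List ℕ) {a b c d}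
         (a∈ : a ∈ S₁) (b∈ : b ∈ S₂) (c∈ : c ∈ S₃) (d∈ : d ∈ S₄) where

  abcd⊆ : (a ∷ b ∷ c ∷ d ∷ []) ⊆ S₁ ++ S₂ ++ S₃ ++ S₄
  abcd⊆ = ++⁺ (Sublist.from∈ a∈) (++⁺ (Sublist.from∈ b∈)
            (++⁺ (Sublist.from∈ c∈) (Sublist.from∈ d∈)))

  contains-2413 : c < a → a < d → d < b → Contains (S₁ ++ S₂ ++ S₃ ++ S₄) (2 ∷ 4 ∷ 1 ∷ 3 ∷ [])
  contains-2413 c<a a<d d<b = _ , abcd⊆ , τ-2413 c<a a<d d<b

  contains-3142 : b < d → d < a → a < c → Contains (S₁ ++ S₂ ++ S₃ ++ S₄) (3 ∷ 1 ∷ 4 ∷ 2 ∷ [])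
  contains-3142 b<d d<a a<c = _ , abcd⊆ , τ-3142 b<d d<a a<c

Even Odd : ℕ → Set
Even n = n % 2 ≡ 0
Odd n = n % 2 ≡ 1

even⊎odd : ∀ n → Even n ⊎ Odd n
even⊎odd zero = inj₁ refl
even⊎odd (suc zero) = inj₂ refl
even⊎odd (suc (suc n)) = even⊎odd n

even-suc : ∀ n → Even n → Odd (suc n)
even-suc zero _ = refl
even-suc (suc zero) ()
even-suc (suc (suc n)) e = even-suc n e

odd-suc⁻¹ : ∀ n → Odd (suc n) → Even n
odd-suc⁻¹ zero _ = refl
odd-suc⁻¹ (suc zero) ()
odd-suc⁻¹ (suc (suc n)) o = odd-suc⁻¹ n o

even-2* : ∀ k → Even (2 * k)
even-2* zero = refl
even-2* (suc k) = subst Even (sym (*-suc 2 k)) (even-2* k)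

+-even : ∀ a {c} → Even c → (a + c) % 2 ≡ a % 2
+-even zero c-even = c-even
+-even (suc zero) {c} c-even = even-suc c c-even
+-even (suc (suc a)) c-even = +-even a c-even

even-+⁻ˡ : ∀ a {b n} → a + b ≡ n → Even n → Even b → Even a
even-+⁻ˡ a a+b≡n n-even b-even = trans (sym (+-even a b-even)) (subst Even (sym a+b≡n) n-even)

odd-+ : ∀ a {b} → Odd (a + b) → (Even a → Odd b) × (Odd a → Even b)
odd-+ zero o = (λ _ → o) , λ ()
odd-+ (suc zero) {b} o = (λ ()) , λ _ → odd-suc⁻¹ b o
odd-+ (suc (suc a)) o = odd-+ a o

-- The Dumont condition on factors

DumontStep : ℕ → ℕ → Set
DumontStep x y = (Even x → y < x) × (Odd x → x < y)

dumontCond-++⁻ʳ : ∀ U {L} → DumontCond (U ++ L) → DumontCond L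
dumontCond-++⁻ʳ [] d = d
dumontCond-++⁻ʳ (u ∷ []) {[]} _ = tt
dumontCond-++⁻ʳ (u ∷ []) {l ∷ L} (_ , _ , d) = d
dumontCond-++⁻ʳ (u ∷ u′ ∷ U) (_ , _ , d) = dumontCond-++⁻ʳ (u′ ∷ U) d

dumontCond⇒linked : ∀ X {y V} → DumontCond (X ++ y ∷ V) → Linked DumontStep (X ++ [ y ])
dumontCond⇒linked [] _ = [-]
dumontCond⇒linked (x ∷ []) (s₀ , s₁ , _) = (s₀ , s₁) ∷ [-]
dumontCond⇒linked (x ∷ x′ ∷ X) (s₀ , s₁ , d) = (s₀ , s₁) ∷ dumontCond⇒linked (x′ ∷ X) d

dumontCond-successor : ∀ U X W {m V} → DumontCond (U ++ X ++ W ++ m ∷ V) →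
                       ∃ λ y → y ∈ W ++ m ∷ V × Linked DumontStep (X ++ [ y ])
dumontCond-successor U X [] d = _ , here refl , dumontCond⇒linked X (dumontCond-++⁻ʳ U d)
dumontCond-successor U X (w ∷ W) d = w , here refl , dumontCond⇒linked X (dumontCond-++⁻ʳ U d)

dumontCond-map : ∀ (f : ℕ → ℕ) X {y} → Linked DumontStep (X ++ [ y ]) →
                 (∀ {x x′} → x ∈ X → x′ ∈ X → DumontStep x x′ → DumontStep (f x) (f x′)) →
                 (∀ {x} → x ∈ X → DumontStep x y → ¬ Even (f x)) →
                 DumontCond (map f X)
dumontCond-map f [] _ _ _ = tt
dumontCond-map f (x ∷ []) (s ∷ [-]) _ last = last (here refl) s
dumontCond-map f (x ∷ x′ ∷ X) (s ∷ steps) step last with step (here refl) (there (here refl)) s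
... | desc , asc =
  desc , asc , dumontCond-map f (x′ ∷ X) steps (λ p q → step (there p) (there q)) (last ∘ there)

linked-successor : ∀ {R : ℕ → ℕ → Set} X {y m} → Linked R (X ++ [ y ]) → m ∈ X →
                   ∃ λ s → s ∈ X ++ [ y ] × R m s
linked-successor (x ∷ []) (r ∷ [-]) (here refl) = _ , there (here refl) , r
linked-successor (x ∷ x′ ∷ X) (r ∷ _) (here refl) = x′ , there (here refl) , r
linked-successor (x ∷ x′ ∷ X) (_ ∷ rs) (there m∈) with linked-successor (x′ ∷ X) rs m∈
... | s , s∈ , r = s , there s∈ , r

minimum : ∀ x X → ∃ λ m → m ∈ x ∷ X × All (m ≤_) (x ∷ X)
minimum x X = min x X , [ here , there ]′ (argmin-sel id x X) , min≤⊤ x X ∷ min≤xs x X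

maximum : ∀ x X → ∃ λ m → m ∈ x ∷ X × All (_≤ m) (x ∷ X)
maximum x X = max x X , [ here , there ]′ (argmax-sel id x X) , ⊥≤max x X ∷ xs≤max x X

rank-offset-even : ∀ {X y c} → Linked DumontStep (X ++ [ y ]) → (∀ {x} → x ∈ X → x < y) →
                   (∀ {x} → x ∈ X → rank X x + c ≡ x) → X ≢ [] → Even c
rank-offset-even {[]} _ _ _ X≢[] = ⊥-elim (X≢[] refl)
rank-offset-even {x₀ ∷ X₀} {y} {c} steps <y shifted _ with minimum x₀ X₀
... | m , m∈ , m≤ = odd-suc⁻¹ c (subst Odd (sym 1+c≡m) m-odd)
  where
  X : List ℕ
  X = x₀ ∷ X₀
  below-m : below m X ≡ 0
  below-m = count-none (_<? m) (All.map (λ m≤z z<m → <⇒≱ z<m m≤z) m≤)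
  1+c≡m : suc c ≡ m
  1+c≡m = trans (cong (λ b → suc (b + c)) (sym below-m)) (shifted m∈)
  m-odd : Odd m
  m-odd with even⊎odd m
  ... | inj₂ o = o
  ... | inj₁ e with linked-successor X steps m∈
  ... | s , s∈ , (desc , _) with ∈-++⁻ X s∈
  ... | inj₁ s∈X = ⊥-elim (<⇒≱ (desc e) (All.lookup m≤ s∈X))
  ... | inj₂ (here refl) = ⊥-elim (<-asym (desc e) (<y m∈))

above-offset-even : ∀ {X y N d} → Linked DumontStep (X ++ [ y ]) → (∀ {x} → x ∈ X → y < x) →
                    (∀ {x} → x ∈ X → d + above x X + x ≡ N) → Even N → X ≢ [] → Even d
above-offset-even {[]} _ _ _ _ X≢[] = ⊥-elim (X≢[] refl)
above-offset-even {x₀ ∷ X₀} {y} {N} {d} steps y< shifted N-even _ with maximum x₀ X₀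
... | m , m∈ , ≤m = even-+⁻ˡ d d+m≡N N-even m-even
  where
  X : List ℕ
  X = x₀ ∷ X₀
  above-m : above m X ≡ 0
  above-m = count-none (m <?_) (All.map (λ z≤m m<z → <⇒≱ m<z z≤m) ≤m)
  d+m≡N : d + m ≡ N
  d+m≡N = trans (cong (_+ m) (sym (+-identityʳ d))) (trans (cong (λ a → d + a + m) (sym above-m)) (shifted m∈))
  m-even : Even m
  m-even with even⊎odd m
  ... | inj₁ e = e
  ... | inj₂ o with linked-successor X steps m∈
  ... | s , s∈ , (_ , asc) with ∈-++⁻ X s∈
  ... | inj₁ s∈X = ⊥-elim (<⇒≱ (asc o) (All.lookup ≤m s∈X))
  ... | inj₂ (here refl) = ⊥-elim (<-asym (asc o) (y< m∈))

τ-isDumont1 : ∀ {X y c} → Unique X → Linked DumontStep (X ++ [ y ]) → (∀ {x} → x ∈ X → x < y) →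
              (∀ {x} → x ∈ X → rank X x + c ≡ x) → Even c → Even (length X) → IsDumont1 (τ X)
τ-isDumont1 {X} {y} {c} u steps <y shifted c-even len-even =
  τ-isPerm X u , trans (cong (_% 2) (length-map (rank X) X)) len-even , dumontCond-map (rank X) X steps step last
  where
  same-parity : ∀ {x} → x ∈ X → rank X x % 2 ≡ x % 2
  same-parity {x} x∈ = trans (sym (+-even (rank X x) c-even)) (cong (_% 2) (shifted x∈))
  step : ∀ {x x′} → x ∈ X → x′ ∈ X → DumontStep x x′ → DumontStep (rank X x) (rank X x′)
  step x∈ x′∈ (desc , asc) = (λ e → rank-preserving X x′∈ x∈ (desc (trans (sym (same-parity x∈)) e)))
                           , (λ o → rank-preserving X x∈ x′∈ (asc (trans (sym (same-parity x∈)) o)))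
  last : ∀ {x} → x ∈ X → DumontStep x y → ¬ Even (rank X x)
  last x∈ (desc , _) e = <-asym (desc (trans (sym (same-parity x∈)) e)) (<y x∈)

corank≡suc-above : ∀ {x} X → Unique X → x ∈ X → corank X x ≡ suc (above x X)
corank≡suc-above {x} X u x∈ = begin
  length X ∸ below x X                          ≡⟨ cong (_∸ below x X) (below+above X u x∈) ⟨
  suc (below x X + above x X) ∸ below x X       ≡⟨ cong (_∸ below x X) (+-suc (below x X) (above x X)) ⟨
  below x X + suc (above x X) ∸ below x X       ≡⟨ m+n∸m≡n (below x X) (suc (above x X)) ⟩
  suc (above x X)                               ∎
  where open ≡-Reasoning

-- The map x ↦ corank X x reverses the order and, N and d being even, the parity of entries of X;
-- together these preserve every Dumont step.
c∘τ-isDumont1 : ∀ {X y N d} → Unique X → Linked DumontStep (X ++ [ y ]) → (∀ {x} → x ∈ X → y < x) →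
                (∀ {x} → x ∈ X → d + above x X + x ≡ N) → Even N → Even d → Even (length X) →
                IsDumont1 (c (τ X))
c∘τ-isDumont1 {X} {y} {N} {d} u steps y< shifted N-even d-even len-even =
  c-isPerm (τ X) (τ-isPerm X u) ,
  trans (cong (_% 2) (trans (length-map _ (τ X)) (length-map (rank X) X))) len-even ,
  subst DumontCond (sym (c∘τ X)) (dumontCond-map (corank X) X steps step last)
  where
  sum≡suc-N : ∀ {x} → x ∈ X → corank X x + x + d ≡ suc N
  sum≡suc-N {x} x∈ = begin
    corank X x + x + d        ≡⟨ cong (λ r → r + x + d) (corank≡suc-above X u x∈) ⟩
    suc (above x X + x + d)   ≡⟨ cong suc (+-comm (above x X + x) d) ⟩
    suc (d + (above x X + x)) ≡⟨ cong suc (+-assoc d (above x X) x) ⟨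
    suc (d + above x X + x)   ≡⟨ cong suc (shifted x∈) ⟩
    suc N                     ∎
    where open ≡-Reasoning
  opposite-parity : ∀ {x} → x ∈ X → (Even (corank X x) → Odd x) × (Odd (corank X x) → Even x)
  opposite-parity {x} x∈ =
    odd-+ (corank X x) (trans (sym (+-even (corank X x + x) d-even))
                              (trans (cong (_% 2) (sum≡suc-N x∈)) (even-suc N N-even)))
  step : ∀ {x x′} → x ∈ X → x′ ∈ X → DumontStep x x′ → DumontStep (corank X x) (corank X x′)
  step x∈ x′∈ (desc , asc) = (λ e → corank-reversing X x∈ x′∈ (asc (proj₁ (opposite-parity x∈) e)))
                           , (λ o → corank-reversing X x′∈ x∈ (desc (proj₂ (opposite-parity x∈) o)))
  last : ∀ {x} → x ∈ X → DumontStep x y → ¬ Even (corank X x)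
  last x∈ (_ , asc) e = <-asym (asc (proj₁ (opposite-parity x∈) e)) (y< x∈)

-- The blocks of a permutation in D¹(2413, 3142)

module Decomposition (k : ℕ) (P A₀ : List ℕ) {N : ℕ}
  (π↭ : P ++ 2 * k ∷ A₀ ++ (2 * k ∸ 1) ∷ [] ↭ range N)
  (N-even : Even N)
  (dc : DumontCond (P ++ 2 * k ∷ A₀ ++ (2 * k ∸ 1) ∷ []))
  (av : Avoids2413-3142 (P ++ 2 * k ∷ A₀ ++ (2 * k ∸ 1) ∷ []))
  where

  M K : ℕ
  M = 2 * k
  K = 2 * k ∸ 1

  end π : List ℕ
  end = M ∷ A₀ ++ K ∷ []
  π = P ++ end

  unique-π : Unique π
  unique-π = unique-↭ (↭-sym π↭) (unique-range N)

  distinct : ∀ S₁ {S₂ x y} → π ≡ S₁ ++ S₂ → x ∈ S₁ → y ∈ S₂ → x ≢ y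
  distinct S₁ π≡ = unique-++-disjoint S₁ (subst Unique π≡ unique-π)

  bounds : ∀ {z} → z ∈ π → 1 ≤ z × z ≤ N
  bounds z∈ = ∈-range⁻ (∈-resp-↭ π↭ z∈)

  K∈end : K ∈ end
  K∈end = there (∈-++⁺ʳ A₀ (here refl))

  1+K≡M : suc K ≡ M
  1+K≡M = 1+[2k∸1]≡2k k (proj₁ (bounds (∈-++⁺ʳ P K∈end)))
    where
    1+[2k∸1]≡2k : ∀ k → 1 ≤ 2 * k ∸ 1 → suc (2 * k ∸ 1) ≡ 2 * k
    1+[2k∸1]≡2k (suc k) _ = refl

  K<M : K < M
  K<M = subst (K <_) 1+K≡M (n<1+n K)

  low⇒¬high : ∀ {z} → z < K → ¬ M < z
  low⇒¬high z<K = <-asym (<-trans z<K K<M)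

  lowOrHigh : ∀ {z} → z ≢ K → z ≢ M → z < K ⊎ M < z
  lowOrHigh {z} z≢K z≢M with <-cmp z K
  ... | tri< z<K _ _ = inj₁ z<K
  ... | tri≈ _ z≡K _ = ⊥-elim (z≢K z≡K)
  ... | tri> _ _ K<z = inj₂ (≤∧≢⇒< (subst (_≤ z) 1+K≡M K<z) (z≢M ∘ sym))

  P-lowOrHigh : ∀ {z} → z ∈ P → z < K ⊎ M < z
  P-lowOrHigh z∈ = lowOrHigh (distinct P refl z∈ K∈end) (distinct P refl z∈ (here refl))

  π-split-at : ∀ S₁ {x S₂} → P ≡ S₁ ++ x ∷ S₂ → π ≡ S₁ ++ [ x ] ++ S₂ ++ end
  π-split-at S₁ {x} {S₂} P≡ = trans (cong (_++ end) P≡) (++-assoc S₁ (x ∷ S₂) end)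

  π-split-prefix : ∀ U X W → P ≡ U ++ X ++ W → π ≡ U ++ X ++ W ++ end
  π-split-prefix U X W P≡ =
    trans (cong (_++ end) P≡) (trans (++-assoc U (X ++ W) end) (cong (U ++_) (++-assoc X W end)))

  π-split-A₀ : π ≡ (P ++ [ M ]) ++ A₀ ++ [ K ]
  π-split-A₀ = sym (++-assoc P [ M ] (A₀ ++ [ K ]))

  π-split-K : π ≡ (P ++ M ∷ A₀) ++ [ K ]
  π-split-K = sym (++-assoc P (M ∷ A₀) [ K ])

  -- (z, b, x, 2k) would be an occurrence of 2413.
  lows-across-high : ∀ S₁ {b S₂ z x} → P ≡ S₁ ++ b ∷ S₂ → M < b →
                     z ∈ S₁ → x ∈ S₂ → z < K → z < x
  lows-across-high S₁ {b} {S₂} {z} {x} P≡ M<b z∈ x∈ z<K with <-cmp z x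
  ... | tri< z<x _ _ = z<x
  ... | tri≈ _ z≡x _ = ⊥-elim (distinct S₁ (π-split-at S₁ P≡) z∈ (there (∈-++⁺ˡ x∈)) z≡x)
  ... | tri> _ _ x<z = ⊥-elim (proj₁ av (subst (λ σ → Contains σ _) (sym (π-split-at S₁ P≡))
                          (contains-2413 S₁ [ b ] S₂ end z∈ (here refl) x∈ (here refl)
                                         x<z (<-trans z<K K<M) M<b)))

  -- (z, a, x, 2k − 1) would be an occurrence of 3142.
  highs-across-low : ∀ S₁ {a S₂ z x} → P ≡ S₁ ++ a ∷ S₂ → a < K →
                     z ∈ S₁ → x ∈ S₂ → M < z → x < z
  highs-across-low S₁ {a} {S₂} {z} {x} P≡ a<K z∈ x∈ M<z with <-cmp x z
  ... | tri< x<z _ _ = x<z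
  ... | tri≈ _ x≡z _ = ⊥-elim (distinct S₁ (π-split-at S₁ P≡) z∈ (there (∈-++⁺ˡ x∈)) (sym x≡z))
  ... | tri> _ _ z<x = ⊥-elim (proj₂ av (subst (λ σ → Contains σ _) (sym (π-split-at S₁ P≡))
                          (contains-3142 S₁ [ a ] S₂ end z∈ (here refl) x∈ K∈end a<K (<-trans K<M M<z) z<x)))

  A₀-head-low : ∀ {h A} → A₀ ≡ h ∷ A → h < K
  A₀-head-low {h} A₀≡ =
    ≤∧≢⇒< (≤-pred (subst (h <_) (sym 1+K≡M) h<M)) (distinct (P ++ M ∷ A₀) π-split-K h∈ (here refl))
    where
    h∈ : h ∈ P ++ M ∷ A₀
    h∈ = ∈-++⁺ʳ P (there (subst (h ∈_) (sym A₀≡) (here refl)))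
    h<M : h < M
    h<M = proj₁ (subst (λ B → DumontCond (M ∷ B ++ [ K ])) A₀≡ (dumontCond-++⁻ʳ P dc)) (even-2* k)

  A₀-low : ∀ {z} → z ∈ A₀ → z < K
  A₀-low {z} z∈ with ∈-∃++ z∈
  ... | [] , _ , A₀≡ = A₀-head-low A₀≡
  ... | h ∷ A₁ , A₂ , A₀≡
    with lowOrHigh (distinct (P ++ M ∷ A₀) π-split-K (∈-++⁺ʳ P (there z∈)) (here refl))
                   (distinct (P ++ [ M ]) π-split-A₀ (∈-++⁺ʳ P (here refl)) (∈-++⁺ˡ z∈) ∘ sym)
  ... | inj₁ z<K = z<K
  ... | inj₂ M<z = ⊥-elim (proj₂ av (subst (λ σ → Contains σ _) π≡
                    (contains-3142 (P ++ [ M ]) [ h ] (A₁ ++ z ∷ A₂) [ K ] (∈-++⁺ʳ P (here refl)) (here refl)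
                                   (∈-++⁺ʳ A₁ (here refl)) (here refl) (A₀-head-low A₀≡) K<M M<z)))
    where
    π≡ : (P ++ [ M ]) ++ [ h ] ++ (A₁ ++ z ∷ A₂) ++ [ K ] ≡ π
    π≡ = sym (trans π-split-A₀ (cong (λ A → (P ++ [ M ]) ++ A ++ [ K ]) A₀≡))

  P-low<A₀ : ∀ {x z} → x ∈ P → x < K → z ∈ A₀ → x < z
  P-low<A₀ {x} {z} x∈ x<K z∈ with <-cmp x z
  ... | tri< x<z _ _ = x<z
  ... | tri≈ _ x≡z _ = ⊥-elim (distinct P refl x∈ (there (∈-++⁺ˡ z∈)) x≡z)
  ... | tri> _ _ z<x =
    ⊥-elim (proj₁ av (contains-2413 P [ M ] A₀ [ K ] x∈ (here refl) z∈ (here refl) z<x x<K K<M))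

  P-low<end : ∀ {x z} → x ∈ P → x < K → z ∈ end → x < z
  P-low<end x∈ x<K (here refl) = <-trans x<K K<M
  P-low<end x∈ x<K (there z∈) with ∈-++⁻ A₀ z∈
  ... | inj₁ z∈A₀ = P-low<A₀ x∈ x<K z∈A₀
  ... | inj₂ (here refl) = x<K

  end<high : ∀ {x z} → M < x → z ∈ end → z < x
  end<high M<x (here refl) = M<x
  end<high M<x (there z∈) with ∈-++⁻ A₀ z∈
  ... | inj₁ z∈A₀ = <-trans (A₀-low z∈A₀) (<-trans K<M M<x)
  ... | inj₂ (here refl) = <-trans K<M M<x

  factor-unique : ∀ U X Y → π ≡ U ++ X ++ Y → Unique X
  factor-unique U X Y π≡ = unique-++⁻ˡ X (unique-++⁻ʳ U (subst Unique π≡ unique-π))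

  factor-⊆ : ∀ U X Y → π ≡ U ++ X ++ Y → X ⊆ π
  factor-⊆ U X Y π≡ = subst (X ⊆_) (sym π≡) (++⁺ˡ U (++⁺ʳ Y ⊆-refl))

  LowRunBounds HighRunBounds : List ℕ → List ℕ → List ℕ → Set
  LowRunBounds U X W =
    (∀ {x} → x ∈ X → below x U ≡ below K U) × (∀ {x z} → x ∈ X → z ∈ W ++ end → x < z)
  HighRunBounds U X W =
    (∀ {x} → x ∈ X → above x U ≡ above M U) × (∀ {x z} → x ∈ X → z ∈ W ++ end → z < x)

  lowRun : ∀ R′ X W → P ≡ reverse R′ ++ X ++ W → Maybe.All (M <_) (head R′) → All (_< K) X →
           (X ≢ [] → Maybe.All (M <_) (head W)) → LowRunBounds (reverse R′) X W
  lowRun R′ X W P≡ R′-high X-low W-high = below-U , after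
    where
    before : ∀ R″ → P ≡ reverse R″ ++ X ++ W → Maybe.All (M <_) (head R″) →
             ∀ {x z} → x ∈ X → z ∈ reverse R″ → z < K → z < x
    before (b ∷ R″) P≡′ (just M<b) x∈ z∈ z<K
      with ∈-++⁻ (reverse R″) (subst (_ ∈_) (unfold-reverse b R″) z∈)
    ... | inj₁ z∈R″ = lows-across-high (reverse R″) P≡″ M<b z∈R″ (∈-++⁺ˡ x∈) z<K
      where
      P≡″ : P ≡ reverse R″ ++ b ∷ X ++ W
      P≡″ = trans P≡′ (trans (cong (_++ X ++ W) (unfold-reverse b R″))
                             (++-assoc (reverse R″) [ b ] (X ++ W)))
    ... | inj₂ (here refl) = ⊥-elim (low⇒¬high z<K M<b)
    later : ∀ W′ → P ≡ reverse R′ ++ X ++ W′ → Maybe.All (M <_) (head W′) →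
            ∀ {x z} → x ∈ X → z ∈ W′ → z < K → x < z
    later (b ∷ W′) _ (just M<b) x∈ (here refl) z<K = ⊥-elim (low⇒¬high z<K M<b)
    later (b ∷ W′) P≡′ (just M<b) x∈ (there z∈) z<K =
      lows-across-high (reverse R′ ++ X) (trans P≡′ (sym (++-assoc (reverse R′) X (b ∷ W′)))) M<b
                       (∈-++⁺ʳ (reverse R′) x∈) z∈ (All.lookup X-low x∈)
    below-U : ∀ {x} → x ∈ X → below x (reverse R′) ≡ below K (reverse R′)
    below-U x∈ = count-cong (_<? _) (_<? K) (All.tabulate λ z∈ →
                   (λ z<x → <-trans z<x (All.lookup X-low x∈)) , before R′ P≡ R′-high x∈ z∈)
    after : ∀ {x z} → x ∈ X → z ∈ W ++ end → x < z
    after {x} {z} x∈ z∈ with ∈-++⁻ W z∈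
    ... | inj₂ z∈end =
      P-low<end (subst (x ∈_) (sym P≡) (∈-++⁺ʳ (reverse R′) (∈-++⁺ˡ x∈))) (All.lookup X-low x∈)
                z∈end
    ... | inj₁ z∈W with P-lowOrHigh (subst (z ∈_) (sym P≡) (∈-++⁺ʳ (reverse R′) (∈-++⁺ʳ X z∈W)))
    ... | inj₁ z<K = later W P≡ (W-high (∈⇒≢[] x∈)) x∈ z∈W z<K
    ... | inj₂ M<z = <-trans (All.lookup X-low x∈) (<-trans K<M M<z)

  highRun : ∀ R′ X W → P ≡ reverse R′ ++ X ++ W → Maybe.All (_< K) (head R′) → All (M <_) X →
            (X ≢ [] → Maybe.All (_< K) (head W)) → HighRunBounds (reverse R′) X W
  highRun R′ X W P≡ R′-low X-high W-low = above-U , after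
    where
    before : ∀ R″ → P ≡ reverse R″ ++ X ++ W → Maybe.All (_< K) (head R″) →
             ∀ {x z} → x ∈ X → z ∈ reverse R″ → M < z → x < z
    before (a ∷ R″) P≡′ (just a<K) x∈ z∈ M<z
      with ∈-++⁻ (reverse R″) (subst (_ ∈_) (unfold-reverse a R″) z∈)
    ... | inj₁ z∈R″ = highs-across-low (reverse R″) P≡″ a<K z∈R″ (∈-++⁺ˡ x∈) M<z
      where
      P≡″ : P ≡ reverse R″ ++ a ∷ X ++ W
      P≡″ = trans P≡′ (trans (cong (_++ X ++ W) (unfold-reverse a R″))
                             (++-assoc (reverse R″) [ a ] (X ++ W)))
    ... | inj₂ (here refl) = ⊥-elim (low⇒¬high a<K M<z)
    later : ∀ W′ → P ≡ reverse R′ ++ X ++ W′ → Maybe.All (_< K) (head W′) →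
            ∀ {x z} → x ∈ X → z ∈ W′ → M < z → z < x
    later (a ∷ W′) _ (just a<K) x∈ (here refl) M<z = ⊥-elim (low⇒¬high a<K M<z)
    later (a ∷ W′) P≡′ (just a<K) x∈ (there z∈) M<z =
      highs-across-low (reverse R′ ++ X) (trans P≡′ (sym (++-assoc (reverse R′) X (a ∷ W′)))) a<K
                       (∈-++⁺ʳ (reverse R′) x∈) z∈ (All.lookup X-high x∈)
    above-U : ∀ {x} → x ∈ X → above x (reverse R′) ≡ above M (reverse R′)
    above-U x∈ = count-cong (_ <?_) (M <?_) (All.tabulate λ z∈ →
                   (λ x<z → <-trans (All.lookup X-high x∈) x<z) , before R′ P≡ R′-low x∈ z∈)
    after : ∀ {x z} → x ∈ X → z ∈ W ++ end → z < x
    after {x} {z} x∈ z∈ with ∈-++⁻ W z∈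
    ... | inj₂ z∈end = end<high (All.lookup X-high x∈) z∈end
    ... | inj₁ z∈W with P-lowOrHigh (subst (z ∈_) (sym P≡) (∈-++⁺ʳ (reverse R′) (∈-++⁺ʳ X z∈W)))
    ... | inj₁ z<K = <-trans z<K (<-trans K<M (All.lookup X-high x∈))
    ... | inj₂ M<z = later W P≡ (W-low (∈⇒≢[] x∈)) x∈ z∈W M<z

  module LowBlock (U X W : List ℕ) (m : ℕ) (V : List ℕ) {c : ℕ}
    (π≡ : π ≡ U ++ X ++ W ++ m ∷ V)
    (below-U : ∀ {x} → x ∈ X → below x U ≡ c)
    (X<after : ∀ {x z} → x ∈ X → z ∈ W ++ m ∷ V → x < z)
    where

    shifted : ∀ {x} → x ∈ X → rank X x + c ≡ x
    shifted = rank-shift U X (W ++ m ∷ V) (subst (_↭ range N) π≡ π↭) below-U X<after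

    successor : ∃ λ y → y ∈ W ++ m ∷ V × Linked DumontStep (X ++ [ y ])
    successor = dumontCond-successor U X W (subst DumontCond π≡ dc)

    offset-even : X ≢ [] → Even c
    offset-even with successor
    ... | _ , y∈ , steps = rank-offset-even steps (λ x∈ → X<after x∈ y∈) shifted

    isDumont1 : Even c → Even (length X) → IsDumont1 (τ X) × Avoids2413-3142 (τ X)
    isDumont1 c-even len-even with successor
    ... | _ , y∈ , steps =
      τ-isDumont1 (factor-unique U X _ π≡) steps (λ x∈ → X<after x∈ y∈) shifted c-even len-even ,
      avoids-τ (factor-⊆ U X _ π≡) av

  module HighBlock (U X W : List ℕ) (m : ℕ) (V : List ℕ) {d : ℕ}
    (π≡ : π ≡ U ++ X ++ W ++ m ∷ V)
    (above-U : ∀ {x} → x ∈ X → above x U ≡ d)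
    (after<X : ∀ {x z} → x ∈ X → z ∈ W ++ m ∷ V → z < x)
    where

    shifted : ∀ {x} → x ∈ X → d + above x X + x ≡ N
    shifted = above-shift U X (W ++ m ∷ V) (subst (_↭ range N) π≡ π↭) above-U after<X

    successor : ∃ λ y → y ∈ W ++ m ∷ V × Linked DumontStep (X ++ [ y ])
    successor = dumontCond-successor U X W (subst DumontCond π≡ dc)

    offset-even : X ≢ [] → Even d
    offset-even with successor
    ... | _ , y∈ , steps = above-offset-even steps (λ x∈ → after<X x∈ y∈) shifted N-even

    isDumont1 : Even d → Even (length X) → IsDumont1 (c (τ X)) × Avoids2413-3142 (c (τ X))
    isDumont1 d-even len-even with successor
    ... | _ , y∈ , steps =
      c∘τ-isDumont1 (factor-unique U X _ π≡) steps (λ x∈ → after<X x∈ y∈) shifted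
                    N-even d-even len-even ,
      avoids-c∘τ (factor-⊆ U X _ π≡) av

  below-before-A₀ : ∀ {x} → x ∈ A₀ → below x (P ++ [ M ]) ≡ below K P
  below-before-A₀ {x} x∈ = begin
    below x (P ++ [ M ])       ≡⟨ count-++ (_<? x) P [ M ] ⟩
    below x P + below x [ M ]  ≡⟨ cong (below x P +_) (count-reject (_<? x) [] (low⇒¬high (A₀-low x∈))) ⟩
    below x P + 0              ≡⟨ +-identityʳ (below x P) ⟩
    below x P                  ≡⟨ count-cong (_<? x) (_<? K) (All.tabulate λ z∈ →
                                    (λ z<x → <-trans z<x (A₀-low x∈)) , λ z<K → P-low<A₀ z∈ z<K x∈) ⟩
    below K P                  ∎
    where open ≡-Reasoning

  A₀<K : ∀ {x z} → x ∈ A₀ → z ∈ [ K ] → x < z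
  A₀<K x∈ (here refl) = A₀-low x∈

  module A₀Block = LowBlock (P ++ [ M ]) A₀ [] K [] π-split-A₀ below-before-A₀ A₀<K

  -- Reading P from right to left, R i is the part of P before Bᵢ, Hi i is Bᵢ and Lo i is Aᵢ₊₁,
  -- all reversed; consumed i is the part of P after R i.
  R : ℕ → List ℕ
  R i = restB k i (reverse P)

  Hi D Lo : ℕ → List ℕ
  Hi i = takeWhileᵇ (high k) (R i)
  D i = dropWhileᵇ (high k) (R i)
  Lo i = takeWhileᵇ (low k) (D i)

  consumed : ℕ → List ℕ
  consumed zero = []
  consumed (suc i) = reverse (Lo i) ++ reverse (Hi i) ++ consumed i

  R-lowOrHigh : ∀ i → All (λ z → z < K ⊎ M < z) (R i)
  R-lowOrHigh zero = All-reverse (All.tabulate P-lowOrHigh)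
  R-lowOrHigh (suc i) = AllP.dropWhile⁺ (T? ∘ low k) (AllP.dropWhile⁺ (T? ∘ high k) (R-lowOrHigh i))

  D-split : ∀ i → D i ≡ Lo i ++ R (suc i)
  D-split i = sym (takeWhile++dropWhile (T? ∘ low k) (D i))

  R-split : ∀ i → R i ≡ Hi i ++ Lo i ++ R (suc i)
  R-split i = trans (sym (takeWhile++dropWhile (T? ∘ high k) (R i))) (cong (Hi i ++_) (D-split i))

  Hi-high : ∀ i → All (M <_) (Hi i)
  Hi-high i = All.map (<ᵇ⇒< M _) (AllP.all-takeWhile (T? ∘ high k) (R i))

  Lo-low : ∀ i → All (_< K) (Lo i)
  Lo-low i = All.map (<ᵇ⇒< _ K) (AllP.all-takeWhile (T? ∘ low k) (D i))

  head-D-low : ∀ i → Maybe.All (_< K) (head (D i))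
  head-D-low i =
    head-resolve (AllP.dropWhile⁺ (T? ∘ high k) (R-lowOrHigh i)) (head-dropWhileᵇ (high k) (R i)) (_∘ <⇒<ᵇ)

  head-R-high : ∀ i → Maybe.All (M <_) (head (R (suc i)))
  head-R-high i =
    head-resolve (All.map swap (R-lowOrHigh (suc i))) (head-dropWhileᵇ (low k) (D i)) (_∘ <⇒<ᵇ)

  Lo≡[]⇒R≡[] : ∀ i → Lo i ≡ [] → R (suc i) ≡ []
  Lo≡[]⇒R≡[] i =
    cong (dropWhileᵇ (low k)) ∘ takeWhileᵇ-≡[] (low k) (D i) (Maybe.map <⇒<ᵇ (head-D-low i))

  Hi≡[]⇒R≡[] : ∀ i → Hi (suc i) ≡ [] → R (suc i) ≡ []
  Hi≡[]⇒R≡[] i = takeWhileᵇ-≡[] (high k) (R (suc i)) (Maybe.map <⇒<ᵇ (head-R-high i))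

  P-split : ∀ i → P ≡ reverse (R i) ++ consumed i
  P-split zero = sym (trans (++-identityʳ (reverse (reverse P))) (reverse-involutive P))
  P-split (suc i) = begin
    P
      ≡⟨ P-split i ⟩
    reverse (R i) ++ consumed i
      ≡⟨ cong (λ L → reverse L ++ consumed i) (R-split i) ⟩
    reverse (Hi i ++ Lo i ++ R′) ++ consumed i
      ≡⟨ cong (_++ consumed i) (reverse-++ (Hi i) (Lo i ++ R′)) ⟩
    (reverse (Lo i ++ R′) ++ reverse (Hi i)) ++ consumed i
      ≡⟨ cong (λ L → (L ++ reverse (Hi i)) ++ consumed i) (reverse-++ (Lo i) R′) ⟩
    ((reverse R′ ++ reverse (Lo i)) ++ reverse (Hi i)) ++ consumed i
      ≡⟨ ++-assoc (reverse R′ ++ reverse (Lo i)) (reverse (Hi i)) (consumed i) ⟩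
    (reverse R′ ++ reverse (Lo i)) ++ reverse (Hi i) ++ consumed i
      ≡⟨ ++-assoc (reverse R′) (reverse (Lo i)) (reverse (Hi i) ++ consumed i) ⟩
    reverse R′ ++ consumed (suc i)
      ∎
    where
    open ≡-Reasoning
    R′ : List ℕ
    R′ = R (suc i)

  P-split-high : ∀ i → P ≡ reverse (D i) ++ reverse (Hi i) ++ consumed i
  P-split-high i = begin
    P                                               ≡⟨ P-split i ⟩
    reverse (R i) ++ consumed i                     ≡⟨ cong (λ L → reverse L ++ consumed i)
                                                            (takeWhile++dropWhile (T? ∘ high k) (R i)) ⟨
    reverse (Hi i ++ D i) ++ consumed i             ≡⟨ cong (_++ consumed i) (reverse-++ (Hi i) (D i)) ⟩
    (reverse (D i) ++ reverse (Hi i)) ++ consumed i ≡⟨ ++-assoc (reverse (D i)) (reverse (Hi i)) (consumed i) ⟩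
    reverse (D i) ++ reverse (Hi i) ++ consumed i   ∎
    where open ≡-Reasoning

  low-next : ∀ i → Lo i ≢ [] → Maybe.All (M <_) (head (reverse (Hi i) ++ consumed i))
  low-next i Lo≢[] with ≡[]⊎≢[] (Hi i)
  ... | inj₂ Hi≢[] = head-++ (consumed i) (All-reverse (Hi-high i)) (Hi≢[] ∘ reverse-injective)
  low-next zero _ | inj₁ Hi≡[] = subst (λ H → Maybe.All (M <_) (head (reverse H ++ []))) (sym Hi≡[]) nothing
  low-next (suc i) Lo≢[] | inj₁ Hi≡[] =
    ⊥-elim (Lo≢[] (cong (takeWhileᵇ (low k) ∘ dropWhileᵇ (high k)) (Hi≡[]⇒R≡[] i Hi≡[])))

  high-next : ∀ i → Hi i ≢ [] → Maybe.All (_< K) (head (consumed i))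
  high-next zero _ = nothing
  high-next (suc i) Hi≢[] =
    head-++ (reverse (Hi i) ++ consumed i) (All-reverse (Lo-low i)) (Hi≢[] ∘ Lo≡[]⇒Hi≡[])
    where
    Lo≡[]⇒Hi≡[] : reverse (Lo i) ≡ [] → Hi (suc i) ≡ []
    Lo≡[]⇒Hi≡[] = cong (takeWhileᵇ (high k)) ∘ Lo≡[]⇒R≡[] i ∘ reverse-injective

  lowRun-bounds : ∀ i → LowRunBounds (reverse (R (suc i))) (reverse (Lo i)) (reverse (Hi i) ++ consumed i)
  lowRun-bounds i = lowRun (R (suc i)) (reverse (Lo i)) (reverse (Hi i) ++ consumed i) (P-split (suc i))
                           (head-R-high i) (All-reverse (Lo-low i)) (low-next i ∘ (_∘ cong reverse))

  lowRun-split : ∀ i → π ≡ reverse (R (suc i)) ++ reverse (Lo i) ++ (reverse (Hi i) ++ consumed i) ++ end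
  lowRun-split i =
    π-split-prefix (reverse (R (suc i))) (reverse (Lo i)) (reverse (Hi i) ++ consumed i) (P-split (suc i))

  module LowRunBlock (i : ℕ) = LowBlock (reverse (R (suc i))) (reverse (Lo i)) (reverse (Hi i) ++ consumed i) M
    (A₀ ++ [ K ]) (lowRun-split i) (proj₁ (lowRun-bounds i)) (proj₂ (lowRun-bounds i))

  highRun-bounds : ∀ i → HighRunBounds (reverse (D i)) (reverse (Hi i)) (consumed i)
  highRun-bounds i = highRun (D i) (reverse (Hi i)) (consumed i) (P-split-high i)
                             (head-D-low i) (All-reverse (Hi-high i)) (high-next i ∘ (_∘ cong reverse))

  highRun-split : ∀ i → π ≡ reverse (D i) ++ reverse (Hi i) ++ consumed i ++ end
  highRun-split i = π-split-prefix (reverse (D i)) (reverse (Hi i)) (consumed i) (P-split-high i)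

  module HighRunBlock (i : ℕ) = HighBlock (reverse (D i)) (reverse (Hi i)) (consumed i) M
    (A₀ ++ [ K ]) (highRun-split i) (proj₁ (highRun-bounds i)) (proj₂ (highRun-bounds i))

  below-K-highs : ∀ {L} → All (M <_) L → below K L ≡ 0
  below-K-highs M<L = count-none (_<? K) (All.map (λ M<z z<K → low⇒¬high z<K M<z) M<L)

  above-M-lows : ∀ {L} → All (_< K) L → above M L ≡ 0
  above-M-lows L<K = count-none (M <?_) (All.map low⇒¬high L<K)

  lows-split : ∀ i → length (Lo i) + below K (R (suc i)) ≡ below K (R i)
  lows-split i = begin
    length (Lo i) + below K (R (suc i))
      ≡⟨ cong (_+ below K (R (suc i))) (count-all (_<? K) (Lo-low i)) ⟨
    below K (Lo i) + below K (R (suc i))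
      ≡⟨ cong₂ _+_ (below-K-highs (Hi-high i)) (count-++ (_<? K) (Lo i) (R (suc i))) ⟨
    below K (Hi i) + below K (Lo i ++ R (suc i))  ≡⟨ count-++ (_<? K) (Hi i) (Lo i ++ R (suc i)) ⟨
    below K (Hi i ++ Lo i ++ R (suc i))           ≡⟨ cong (below K) (R-split i) ⟨
    below K (R i)                                 ∎
    where open ≡-Reasoning

  above-D : ∀ i → above M (D i) ≡ above M (R (suc i))
  above-D i = begin
    above M (D i)                                 ≡⟨ cong (above M) (D-split i) ⟩
    above M (Lo i ++ R (suc i))                   ≡⟨ count-++ (M <?_) (Lo i) (R (suc i)) ⟩
    above M (Lo i) + above M (R (suc i))          ≡⟨ cong (_+ above M (R (suc i))) (above-M-lows (Lo-low i)) ⟩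
    above M (R (suc i))                           ∎
    where open ≡-Reasoning

  highs-split : ∀ i → length (Hi i) + above M (R (suc i)) ≡ above M (R i)
  highs-split i = begin
    length (Hi i) + above M (R (suc i))           ≡⟨ cong₂ _+_ (count-all (M <?_) (Hi-high i)) (above-D i) ⟨
    above M (Hi i) + above M (D i)                ≡⟨ count-++ (M <?_) (Hi i) (D i) ⟨
    above M (Hi i ++ D i)                         ≡⟨ cong (above M) (takeWhile++dropWhile (T? ∘ high k) (R i)) ⟩
    above M (R i)                                 ∎
    where open ≡-Reasoning

  lows-before-run : ∀ i → below K (reverse (R (suc i))) ≡ below K (R (suc i))
  lows-before-run i = count-↭ (_<? K) (↭-reverse (R (suc i)))

  highs-before-run : ∀ i → above M (reverse (D i)) ≡ above M (R (suc i))
  highs-before-run i = trans (count-↭ (M <?_) (↭-reverse (D i))) (above-D i)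

  K-bounds : 1 ≤ K × K ≤ N
  K-bounds = bounds (∈-++⁺ʳ P K∈end)

  A₀+below-P : length A₀ + below K P ≡ K ∸ 1
  A₀+below-P = begin
    length A₀ + below K P        ≡⟨ +-comm (length A₀) (below K P) ⟩
    below K P + length A₀        ≡⟨ cong (below K P +_) below-end ⟨
    below K P + below K end      ≡⟨ count-++ (_<? K) P end ⟨
    below K π                    ≡⟨ count-↭ (_<? K) π↭ ⟩
    below K (range N)            ≡⟨ below-range N (m≤n⇒m≤1+n (proj₂ K-bounds)) ⟩
    K ∸ 1                        ∎
    where
    open ≡-Reasoning
    below-end : below K end ≡ length A₀
    below-end = begin
      below K (M ∷ A₀ ++ [ K ])     ≡⟨ count-reject (_<? K) (A₀ ++ [ K ]) (<-asym K<M) ⟩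
      below K (A₀ ++ [ K ])         ≡⟨ count-++ (_<? K) A₀ [ K ] ⟩
      below K A₀ + below K [ K ]    ≡⟨ cong₂ _+_ (count-all (_<? K) (All.tabulate A₀-low))
                                                 (count-reject (_<? K) [] (<-irrefl refl)) ⟩
      length A₀ + 0                 ≡⟨ +-identityʳ (length A₀) ⟩
      length A₀                     ∎

  above-P : above M P ≡ N ∸ M
  above-P = begin
    above M P                    ≡⟨ +-identityʳ (above M P) ⟨
    above M P + 0                ≡⟨ cong (above M P +_) above-end ⟨
    above M P + above M end      ≡⟨ count-++ (M <?_) P end ⟨
    above M π                    ≡⟨ count-↭ (M <?_) π↭ ⟩
    above M (range N)            ≡⟨ above-range N M ⟩
    N ∸ M                        ∎
    where
    open ≡-Reasoning
    above-end : above M end ≡ 0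
    above-end = count-none (M <?_) (All.tabulate λ z∈ M<z → <-irrefl refl (end<high M<z z∈))

  K∸1-even : Even (K ∸ 1)
  K∸1-even = subst Even (sym (trans (cong suc (m+[n∸m]≡n (proj₁ K-bounds))) 1+K≡M)) (even-2* k)

  below-P-even : Even (below K P)
  below-P-even with ≡[]⊎≢[] A₀
  ... | inj₁ A₀≡[] = subst Even (sym (trans (cong (λ A → length A + below K P) (sym A₀≡[])) A₀+below-P))
                            K∸1-even
  ... | inj₂ A₀≢[] = A₀Block.offset-even A₀≢[]

  lows-even : ∀ i → Even (below K (R i))
  lows-even zero = subst Even (sym (count-↭ (_<? K) (↭-reverse P))) below-P-even
  lows-even (suc i) with ≡[]⊎≢[] (Lo i)
  ... | inj₁ Lo≡[] =
    subst Even (sym (trans (cong (λ L → length L + below K (R (suc i))) (sym Lo≡[])) (lows-split i)))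
          (lows-even i)
  ... | inj₂ Lo≢[] = subst Even (lows-before-run i) (LowRunBlock.offset-even i (Lo≢[] ∘ reverse-injective))

  highs-even : ∀ i → Even (above M (R i))
  highs-even zero =
    subst Even (sym (trans (count-↭ (M <?_) (↭-reverse P)) above-P))
          (even-+⁻ˡ (N ∸ M) (m∸n+n≡m (proj₂ (bounds (∈-++⁺ʳ P (here refl))))) N-even (even-2* k))
  highs-even (suc i) with ≡[]⊎≢[] (Hi i)
  ... | inj₁ Hi≡[] =
    subst Even (sym (trans (cong (λ L → length L + above M (R (suc i))) (sym Hi≡[])) (highs-split i)))
          (highs-even i)
  ... | inj₂ Hi≢[] = subst Even (highs-before-run i) (HighRunBlock.offset-even i (Hi≢[] ∘ reverse-injective))

  blockA-isDumont1 : ∀ i → IsDumont1 (τ (blockA k A₀ P i)) × Avoids2413-3142 (τ (blockA k A₀ P i))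
  blockA-isDumont1 zero =
    A₀Block.isDumont1 below-P-even (even-+⁻ˡ (length A₀) A₀+below-P K∸1-even below-P-even)
  blockA-isDumont1 (suc i) = LowRunBlock.isDumont1 i
    (subst Even (sym (lows-before-run i)) (lows-even (suc i)))
    (subst Even (sym (length-reverse (Lo i)))
           (even-+⁻ˡ (length (Lo i)) (lows-split i) (lows-even i) (lows-even (suc i))))

  blockB-isDumont1 : ∀ i → IsDumont1 (c (τ (blockB k P i))) × Avoids2413-3142 (c (τ (blockB k P i)))
  blockB-isDumont1 i = HighRunBlock.isDumont1 i
    (subst Even (sym (highs-before-run i)) (highs-even (suc i)))
    (subst Even (sym (length-reverse (Hi i)))
           (even-+⁻ˡ (length (Hi i)) (highs-split i) (highs-even i) (highs-even (suc i))))

lemma4 : (n k : ℕ) (π P A₀ : List ℕ) →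
    1 ≤ n → InD1 n π →
    π ≡ P ++ (2 * k) ∷ A₀ ++ (2 * k ∸ 1) ∷ [] →
    (∀ i → IsDumont1 (τ (blockA k A₀ P i)) × Avoids2413-3142 (τ (blockA k A₀ P i)))
    × (∀ i → IsDumont1 (c (τ (blockB k P i))) × Avoids2413-3142 (c (τ (blockB k P i))))
lemma4 n k π P A₀ _ (length≡2n , (π-perm , _ , dc) , av) refl = blockA-isDumont1 , blockB-isDumont1
  where
  π↭ : π ↭ range (2 * n)
  π↭ = subst (λ m → π ↭ range m) length≡2n π-perm
  open Decomposition k P A₀ π↭ (even-2* n) dc av
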